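{- Let $A$ be an srl-monoid and $a\in A^{ - }$. Then \[ \mathsf{C}[a] = \{x\in A: \square^{n}(a^{m}) \leq x \text{ and } x\cdot \square^{n}(a^{m}) \leq e \text{ for some } n,m\in \mathbb{N}\}. \] Moreover, if $x\in A^{ - }$ then $x\in \mathsf{C}[a]$ if and only if there are $n,m\in\mathbb{N}$ such that $\square^{n}(a^{m}) \leq x$.
   Context: A commutative l-monoid is an algebra $(A,\wedge,\vee,\cdot,e)$ of type $(2,2,2,0)$ such that $(A,\wedge,\vee)$ is a lattice, $(A,\cdot,e)$ is a commutative monoid and $(a\vee b)\cdot c=(a\cdot c)\vee(b\cdot c)$ for all $a,b,c\in A$. An algebra $(A,\wedge,\vee,\cdot,\rightarrow,e)$ of type $(2,2,2,2,0)$ is an srl-monoid if $(A,\wedge,\vee,\cdot,e)$ is a commutative l-monoid and there is a subalgebra $Q$ of $(A,\wedge,\vee,\cdot,e)$ such that for all $a,b\in A$ the set $\{q\in Q: a\cdot q\leq b\}$ has a maximum and $a\rightarrow b$ equals this maximum. $A^{ - }=\{a\in A: a\le e\}$. $a^0=e$, $a^{n+1}=a\cdot a^n$. $\square(a)=e\rightarrow a$; $\square^0(a)=a$, $\square^1(a)=\square(a)$ and $\square^{n+1}(a)=\square(a)\cdot\square^n(a)$ for $n\ge1$. $\mathbb{N}=\{0,1,2,\dots\}$. A convex subalgebra is a subalgebra $H$ of $(A,\wedge,\vee,\cdot,\rightarrow,e)$ such that $a,b\in H$, $a\le c\le b$ imply $c\in H$; it is strongly convex if for all $a\in A$, $h\in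 H$ with $a\cdot h\le e\le h\rightarrow a$ one has $a\in H$. $\mathsf{C}[a]$ is the smallest strongly convex subalgebra of $A$ containing $a$. -}

module Defs where

open import Level using (Level; suc; _⊔_)
open import Data.Nat using (ℕ; zero) renaming (suc to sucℕ)
open import Data.Product using (_×_; ∃-syntax)
open import Relation.Binary.PropositionalEquality using (_≡_)

record SrlMonoid (ℓ : Level) : Set (suc ℓ) where
  infixr 7 _·_
  infixr 6 _∧_
  infixr 5 _∨_
  infixr 4 _⇒_
  infix  3 _≤_
  field
    Carrier : Set ℓ
    _∧_ _∨_ _·_ _⇒_ : Carrier → Carrier → Carrier
    e : Carrier
    ∧-comm   : ∀ a b → a ∧ b ≡ b ∧ a
    ∨-comm   : ∀ a b → a ∨ b ≡ b ∨ a
    ∧-assoc  : ∀ a b c → (a ∧ b) ∧ c ≡ a ∧ (b ∧ c)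
    ∨-assoc  : ∀ a b c → (a ∨ b) ∨ c ≡ a ∨ (b ∨ c)
    ∧-absorbs-∨ : ∀ a b → a ∧ (a ∨ b) ≡ a
    ∨-absorbs-∧ : ∀ a b → a ∨ (a ∧ b) ≡ a
    ·-assoc  : ∀ a b c → (a · b) · c ≡ a · (b · c)
    ·-comm   : ∀ a b → a · b ≡ b · a
    ·-identityˡ : ∀ a → e · a ≡ a
    ·-distrib-∨ : ∀ a b c → (a ∨ b) · c ≡ (a · c) ∨ (b · c)

  _≤_ : Carrier → Carrier → Set ℓ
  a ≤ b = a ∧ b ≡ a

  field
    Q : Carrier → Set ℓ
    Q-∧ : ∀ {a b} → Q a → Q b → Q (a ∧ b)
    Q-∨ : ∀ {a b} → Q a → Q b → Q (a ∨ b)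
    Q-· : ∀ {a b} → Q a → Q b → Q (a · b)
    Q-e : Q e
    ⇒-Q   : ∀ a b → Q (a ⇒ b)
    ⇒-res : ∀ a b → a · (a ⇒ b) ≤ b
    ⇒-max : ∀ a b q → Q q → a · q ≤ b → q ≤ a ⇒ b

module SrlNotions {ℓ : Level} (A : SrlMonoid ℓ) where
  open SrlMonoid A

  Neg : Carrier → Set ℓ
  Neg a = a ≤ e

  _^_ : Carrier → ℕ → Carrier
  a ^ zero = e
  a ^ sucℕ n = a · (a ^ n)

  □ : Carrier → Carrier
  □ a = e ⇒ a

  □^ : ℕ → Carrier → Carrier
  □^ zero a = a
  □^ (sucℕ zero) a = □ a
  □^ (sucℕ (sucℕ n)) a = □ a · □^ (sucℕ n) a

  record IsSubalgebra (H : Carrier → Set ℓ) : Set ℓ where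
    field
      H-∧ : ∀ {a b} → H a → H b → H (a ∧ b)
      H-∨ : ∀ {a b} → H a → H b → H (a ∨ b)
      H-· : ∀ {a b} → H a → H b → H (a · b)
      H-⇒ : ∀ {a b} → H a → H b → H (a ⇒ b)
      H-e : H e

  record IsConvexSubalgebra (H : Carrier → Set ℓ) : Set ℓ where
    field
      subalgebra : IsSubalgebra H
      convex : ∀ {a b c} → H a → H b → a ≤ c → c ≤ b → H c

  record IsStronglyConvex (H : Carrier → Set ℓ) : Set ℓ where
    field
      convexSubalgebra : IsConvexSubalgebra H
      strong : ∀ a h → H h → a · h ≤ e → e ≤ h ⇒ a → H a

  C[_] : Carrier → Carrier → Set (suc ℓ)
  C[ a ] x = ∀ (H : Carrier → Set ℓ) → IsStronglyConvex H → H a → H x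

-- The elements β n m = □ⁿ(aᵐ) are negative, decrease in both indices, and
-- doubling the index squares them: β (2k+2) m = β (k+1) m · β (k+1) m with
-- β (k+1) m ∈ Q. So the set of x with β n m ≤ x and x · β n m ≤ e for some n, m
-- is a strongly convex subalgebra containing a (for x → y the square, being in
-- Q, lies below x → y by maximality). Conversely a strongly convex subalgebra
-- containing a contains every β n m, and x · β n m ≤ e ≤ β n m → x then puts
-- x into it.
module Submission where

open import Defs
open import Level using (Level)
open import Algebra.Bundles using (CommutativeSemigroup)
import Algebra.Properties.CommutativeSemigroup as CommutativeSemigroupProperties
open import Data.Nat using (ℕ; zero; suc; _+_; _⊔_; _≤′_; ≤′-reflexive; ≤′-step; z≤n)
  renaming (_≤_ to _≤ℕ_)
open import Data.Nat.Properties using (≤⇒≤′; m≤m⊔n; m≤n⊔m; m≤n⇒m≤1+n)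
open import Data.Product using (_×_; _,_; ∃-syntax)
open import Function.Bundles using (_⇔_; mk⇔; Equivalence)
open import Relation.Binary.Bundles using (Poset)
open import Relation.Binary.PropositionalEquality
  using (_≡_; refl; sym; trans; cong; cong₂; isEquivalence)
import Relation.Binary.Reasoning.PartialOrder as PartialOrderReasoning

module SrlProperties {ℓ : Level} (A : SrlMonoid ℓ) where
  open SrlMonoid A
  open SrlNotions A

  ∧-idem : ∀ x → x ∧ x ≡ x
  ∧-idem x = trans (cong (x ∧_) (sym (∨-absorbs-∧ x x))) (∧-absorbs-∨ x (x ∧ x))

  ≤-refl : ∀ {x} → x ≤ x
  ≤-refl {x} = ∧-idem x

  ≤-reflexive : ∀ {x y} → x ≡ y → x ≤ y
  ≤-reflexive refl = ≤-refl

  ≤-trans : ∀ {x y z} → x ≤ y → y ≤ z → x ≤ z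
  ≤-trans {x} {y} {z} x≤y y≤z =
    trans (cong (_∧ z) (sym x≤y)) (trans (∧-assoc x y z) (trans (cong (x ∧_) y≤z) x≤y))

  ≤-antisym : ∀ {x y} → x ≤ y → y ≤ x → x ≡ y
  ≤-antisym {x} {y} x≤y y≤x = trans (sym x≤y) (trans (∧-comm x y) y≤x)

  poset : Poset ℓ ℓ ℓ
  poset = record
    { _≈_ = _≡_
    ; _≤_ = _≤_
    ; isPartialOrder = record
      { isPreorder = record
        { isEquivalence = isEquivalence
        ; reflexive = ≤-reflexive
        ; trans = ≤-trans
        }
      ; antisym = ≤-antisym
      }
    }

  open PartialOrderReasoning poset

  x∧y≤x : ∀ x y → x ∧ y ≤ x
  x∧y≤x x y = begin-equality
    (x ∧ y) ∧ x ≡⟨ ∧-assoc x y x ⟩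
    x ∧ (y ∧ x) ≡⟨ cong (x ∧_) (∧-comm y x) ⟩
    x ∧ (x ∧ y) ≡⟨ ∧-assoc x x y ⟨
    (x ∧ x) ∧ y ≡⟨ cong (_∧ y) (∧-idem x) ⟩
    x ∧ y       ∎

  ∧-greatest : ∀ {x y z} → x ≤ y → x ≤ z → x ≤ y ∧ z
  ∧-greatest {x} {y} {z} x≤y x≤z = trans (sym (∧-assoc x y z)) (trans (cong (_∧ z) x≤y) x≤z)

  x≤x∨y : ∀ x y → x ≤ x ∨ y
  x≤x∨y = ∧-absorbs-∨

  ≤⇒∨≡ : ∀ {x y} → x ≤ y → x ∨ y ≡ y
  ≤⇒∨≡ {x} {y} x≤y = begin-equality
    x ∨ y       ≡⟨ cong (_∨ y) (sym x≤y) ⟩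
    (x ∧ y) ∨ y ≡⟨ ∨-comm (x ∧ y) y ⟩
    y ∨ (x ∧ y) ≡⟨ cong (y ∨_) (∧-comm x y) ⟩
    y ∨ (y ∧ x) ≡⟨ ∨-absorbs-∧ y x ⟩
    y           ∎

  ∨≡⇒≤ : ∀ {x y} → x ∨ y ≡ y → x ≤ y
  ∨≡⇒≤ {x} {y} x∨y≡y = trans (cong (x ∧_) (sym x∨y≡y)) (∧-absorbs-∨ x y)

  ∨-least : ∀ {x y z} → x ≤ z → y ≤ z → x ∨ y ≤ z
  ∨-least {x} {y} {z} x≤z y≤z =
    ∨≡⇒≤ (trans (∨-assoc x y z) (trans (cong (x ∨_) (≤⇒∨≡ y≤z)) (≤⇒∨≡ x≤z)))

  ·-identityʳ : ∀ x → x · e ≡ x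
  ·-identityʳ x = trans (·-comm x e) (·-identityˡ x)

  ·-commutativeSemigroup : CommutativeSemigroup ℓ ℓ
  ·-commutativeSemigroup = record
    { _≈_ = _≡_
    ; _∙_ = _·_
    ; isCommutativeSemigroup = record
      { isSemigroup = record
        { isMagma = record { isEquivalence = isEquivalence ; ∙-cong = cong₂ _·_ }
        ; assoc = ·-assoc
        }
      ; comm = ·-comm
      }
    }

  open CommutativeSemigroupProperties ·-commutativeSemigroup public using (interchange)

  ·-monoˡ-≤ : ∀ {x y} z → x ≤ y → x · z ≤ y · z
  ·-monoˡ-≤ {x} {y} z x≤y = ∨≡⇒≤ (trans (sym (·-distrib-∨ x y z)) (cong (_· z) (≤⇒∨≡ x≤y)))

  ·-monoʳ-≤ : ∀ {x y} z → x ≤ y → z · x ≤ z · y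
  ·-monoʳ-≤ {x} {y} z x≤y = begin
    z · x ≡⟨ ·-comm z x ⟩
    x · z ≤⟨ ·-monoˡ-≤ z x≤y ⟩
    y · z ≡⟨ ·-comm y z ⟩
    z · y ∎

  ·-mono-≤ : ∀ {x x′ y y′} → x ≤ x′ → y ≤ y′ → x · y ≤ x′ · y′
  ·-mono-≤ {x′ = x′} {y = y} x≤x′ y≤y′ = ≤-trans (·-monoˡ-≤ y x≤x′) (·-monoʳ-≤ x′ y≤y′)

  Neg-· : ∀ {x y} → Neg x → Neg y → Neg (x · y)
  Neg-· x≤e y≤e = ≤-trans (·-mono-≤ x≤e y≤e) (≤-reflexive (·-identityˡ e))

  ·-neg-≤ʳ : ∀ {x} y → Neg x → x · y ≤ y
  ·-neg-≤ʳ y x≤e = ≤-trans (·-monoˡ-≤ y x≤e) (≤-reflexive (·-identityˡ y))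

  ⇒-≤-from-e : ∀ {x y} → e ≤ x ⇒ y → x ≤ y
  ⇒-≤-from-e {x} {y} e≤x⇒y = begin
    x           ≡⟨ ·-identityʳ x ⟨
    x · e       ≤⟨ ·-monoʳ-≤ x e≤x⇒y ⟩
    x · (x ⇒ y) ≤⟨ ⇒-res x y ⟩
    y           ∎

  antitone-from-step : (f : ℕ → Carrier) → (∀ n → f (suc n) ≤ f n) →
                       ∀ {n n′} → n ≤ℕ n′ → f n′ ≤ f n
  antitone-from-step f step n≤n′ = go (≤⇒≤′ n≤n′)
    where
    go : ∀ {n n′} → n ≤′ n′ → f n′ ≤ f n
    go (≤′-reflexive refl) = ≤-refl
    go (≤′-step n≤′n′)    = ≤-trans (step _) (go n≤′n′)

  ^-antitone : ∀ {x} → Neg x → ∀ {m m′} → m ≤ℕ m′ → x ^ m′ ≤ x ^ m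
  ^-antitone {x} x≤e = antitone-from-step (x ^_) (λ m → ·-neg-≤ʳ (x ^ m) x≤e)

  □-deflationary : ∀ x → □ x ≤ x
  □-deflationary x = ≤-trans (≤-reflexive (sym (·-identityˡ (□ x)))) (⇒-res e x)

  □-mono : ∀ {x y} → x ≤ y → □ x ≤ □ y
  □-mono {x} {y} x≤y = ⇒-max e y (□ x) (⇒-Q e x) (≤-trans (⇒-res e x) x≤y)

  □^-mono : ∀ {x y} → x ≤ y → ∀ n → □^ n x ≤ □^ n y
  □^-mono x≤y zero            = x≤y
  □^-mono x≤y (suc zero)      = □-mono x≤y
  □^-mono x≤y (suc (suc n))   = ·-mono-≤ (□-mono x≤y) (□^-mono x≤y (suc n))

  □^-antitone : ∀ {x} → Neg x → ∀ {n n′} → n ≤ℕ n′ → □^ n′ x ≤ □^ n x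
  □^-antitone {x} x≤e = antitone-from-step (λ n → □^ n x) step
    where
    step : ∀ n → □^ (suc n) x ≤ □^ n x
    step zero    = □-deflationary x
    step (suc n) = ·-neg-≤ʳ (□^ (suc n) x) (≤-trans (□-deflationary x) x≤e)

  Q-□^-suc : ∀ x n → Q (□^ (suc n) x)
  Q-□^-suc x zero    = ⇒-Q e x
  Q-□^-suc x (suc n) = Q-· (⇒-Q e x) (Q-□^-suc x n)

  □^-suc-+ : ∀ x k j → □^ (suc k + suc j) x ≡ □^ (suc k) x · □^ (suc j) x
  □^-suc-+ x zero    j = refl
  □^-suc-+ x (suc k) j = begin-equality
    □ x · □^ (suc k + suc j) x          ≡⟨ cong (□ x ·_) (□^-suc-+ x k j) ⟩
    □ x · (□^ (suc k) x · □^ (suc j) x) ≡⟨ ·-assoc (□ x) _ _ ⟨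
    □^ (suc (suc k)) x · □^ (suc j) x   ∎

module SubalgebraProperties {ℓ : Level} (A : SrlMonoid ℓ) {H : SrlMonoid.Carrier A → Set ℓ}
                           (H-sub : SrlNotions.IsSubalgebra A H) where
  open SrlNotions A
  open IsSubalgebra H-sub

  H-^ : ∀ {x} → H x → ∀ m → H (x ^ m)
  H-^ Hx zero    = H-e
  H-^ Hx (suc m) = H-· Hx (H-^ Hx m)

  H-□^ : ∀ {x} → H x → ∀ n → H (□^ n x)
  H-□^ Hx zero          = Hx
  H-□^ Hx (suc zero)    = H-⇒ H-e Hx
  H-□^ Hx (suc (suc n)) = H-· (H-⇒ H-e Hx) (H-□^ Hx (suc n))

module BoxPowerBounds {ℓ : Level} (A : SrlMonoid ℓ) (a : SrlMonoid.Carrier A)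
                      (a≤e : SrlNotions.Neg A a) where
  open SrlMonoid A
  open SrlNotions A
  open SrlProperties A
  open PartialOrderReasoning poset

  β : ℕ → ℕ → Carrier
  β n m = □^ n (a ^ m)

  Neg-^ : ∀ m → Neg (a ^ m)
  Neg-^ m = ^-antitone a≤e {0} {m} z≤n

  β-antitone : ∀ {n m n′ m′} → n ≤ℕ n′ → m ≤ℕ m′ → β n′ m′ ≤ β n m
  β-antitone {n} {m} {n′} {m′} n≤n′ m≤m′ = begin
    □^ n′ (a ^ m′) ≤⟨ □^-mono (^-antitone a≤e m≤m′) n′ ⟩
    □^ n′ (a ^ m)  ≤⟨ □^-antitone (Neg-^ m) n≤n′ ⟩
    □^ n  (a ^ m)  ∎

  Neg-β : ∀ n m → Neg (β n m)
  Neg-β n m = β-antitone {n′ = n} {m′ = m} z≤n z≤n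

  β-double : ∀ k m → β (suc k + suc k) m ≡ β (suc k) m · β (suc k) m
  β-double k m = □^-suc-+ (a ^ m) k k

  BoundedAt : Carrier → ℕ → ℕ → Set ℓ
  BoundedAt x n m = β n m ≤ x × x · β n m ≤ e

  Bounded : Carrier → Set ℓ
  Bounded x = ∃[ n ] ∃[ m ] BoundedAt x n m

  boundedAt-weaken : ∀ {x n m n′ m′} → n ≤ℕ n′ → m ≤ℕ m′ → BoundedAt x n m → BoundedAt x n′ m′
  boundedAt-weaken {x} n≤n′ m≤m′ (β≤x , xβ≤e) =
    ≤-trans β′≤β β≤x , ≤-trans (·-monoʳ-≤ x β′≤β) xβ≤e
    where β′≤β = β-antitone n≤n′ m≤m′

  bounded-common : ∀ {x y} → Bounded x → Bounded y →
                   ∃[ k ] ∃[ m ] BoundedAt x (suc k) m × BoundedAt y (suc k) m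
  bounded-common (n , m , x-at) (n′ , m′ , y-at) =
    n ⊔ n′ , m ⊔ m′ ,
    boundedAt-weaken (m≤n⇒m≤1+n (m≤m⊔n n n′)) (m≤m⊔n m m′) x-at ,
    boundedAt-weaken (m≤n⇒m≤1+n (m≤n⊔m n n′)) (m≤n⊔m m m′) y-at

  bounded-∧ : ∀ {x y} → Bounded x → Bounded y → Bounded (x ∧ y)
  bounded-∧ {x} {y} bx by with bounded-common bx by
  ... | k , m , (b≤x , xb≤e) , (b≤y , _) =
    suc k , m , ∧-greatest b≤x b≤y , ≤-trans (·-monoˡ-≤ _ (x∧y≤x x y)) xb≤e

  bounded-∨ : ∀ {x y} → Bounded x → Bounded y → Bounded (x ∨ y)
  bounded-∨ {x} {y} bx by with bounded-common bx by
  ... | k , m , (b≤x , xb≤e) , (_ , yb≤e) =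
    suc k , m , ≤-trans b≤x (x≤x∨y x y) ,
    ≤-trans (≤-reflexive (·-distrib-∨ x y _)) (∨-least xb≤e yb≤e)

  bounded-· : ∀ {x y} → Bounded x → Bounded y → Bounded (x · y)
  bounded-· {x} {y} bx by with bounded-common bx by
  ... | k , m , (b≤x , xb≤e) , (b≤y , yb≤e) =
    suc k + suc k , m , bb≤xy , xybb≤e
    where
    b : Carrier
    b = β (suc k) m
    bb≤xy : β (suc k + suc k) m ≤ x · y
    bb≤xy = begin
      β (suc k + suc k) m ≡⟨ β-double k m ⟩
      b · b               ≤⟨ ·-mono-≤ b≤x b≤y ⟩
      x · y               ∎
    xybb≤e : (x · y) · β (suc k + suc k) m ≤ e
    xybb≤e = begin
      (x · y) · β (suc k + suc k) m ≡⟨ cong ((x · y) ·_) (β-double k m) ⟩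
      (x · y) · (b · b)             ≡⟨ interchange x y b b ⟩
      (x · b) · (y · b)             ≤⟨ Neg-· xb≤e yb≤e ⟩
      e                             ∎

  bounded-⇒ : ∀ {x y} → Bounded x → Bounded y → Bounded (x ⇒ y)
  bounded-⇒ {x} {y} bx by with bounded-common bx by
  ... | k , m , (b≤x , xb≤e) , (b≤y , yb≤e) =
    suc k + suc k , m , bb≤x⇒y , x⇒y·bb≤e
    where
    b : Carrier
    b = β (suc k) m
    x·bb≤y : x · (b · b) ≤ y
    x·bb≤y = begin
      x · (b · b) ≡⟨ ·-assoc x b b ⟨
      (x · b) · b ≤⟨ ·-neg-≤ʳ b xb≤e ⟩
      b           ≤⟨ b≤y ⟩
      y           ∎
    bb≤x⇒y : β (suc k + suc k) m ≤ x ⇒ y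
    bb≤x⇒y = begin
      β (suc k + suc k) m ≡⟨ β-double k m ⟩
      b · b               ≤⟨ ⇒-max x y (b · b) (Q-· (Q-□^-suc _ k) (Q-□^-suc _ k)) x·bb≤y ⟩
      x ⇒ y               ∎
    x⇒y·bb≤e : (x ⇒ y) · β (suc k + suc k) m ≤ e
    x⇒y·bb≤e = begin
      (x ⇒ y) · β (suc k + suc k) m ≡⟨ cong ((x ⇒ y) ·_) (β-double k m) ⟩
      (x ⇒ y) · (b · b)             ≡⟨ ·-assoc (x ⇒ y) b b ⟨
      ((x ⇒ y) · b) · b             ≤⟨ ·-monoˡ-≤ b (·-monoʳ-≤ (x ⇒ y) b≤x) ⟩
      ((x ⇒ y) · x) · b             ≡⟨ cong (_· b) (·-comm (x ⇒ y) x) ⟩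
      (x · (x ⇒ y)) · b             ≤⟨ ·-monoˡ-≤ b (⇒-res x y) ⟩
      y · b                         ≤⟨ yb≤e ⟩
      e                             ∎

  bounded-convex : ∀ {x y z} → Bounded x → Bounded y → x ≤ z → z ≤ y → Bounded z
  bounded-convex bx by x≤z z≤y with bounded-common bx by
  ... | k , m , (b≤x , _) , (_ , yb≤e) =
    suc k , m , ≤-trans b≤x x≤z , ≤-trans (·-monoˡ-≤ _ z≤y) yb≤e

  bounded-strong : ∀ x h → Bounded h → x · h ≤ e → e ≤ h ⇒ x → Bounded x
  bounded-strong x h (n , m , b≤h , _) xh≤e e≤h⇒x =
    n , m , ≤-trans b≤h h≤x , ≤-trans (·-monoʳ-≤ x b≤h) xh≤e
    where
    h≤x : h ≤ x
    h≤x = ⇒-≤-from-e e≤h⇒x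

  bounded-stronglyConvex : IsStronglyConvex Bounded
  bounded-stronglyConvex = record
    { convexSubalgebra = record
      { subalgebra = record
        { H-∧ = bounded-∧ ; H-∨ = bounded-∨ ; H-· = bounded-· ; H-⇒ = bounded-⇒
        ; H-e = 0 , 0 , ≤-refl , ≤-reflexive (·-identityˡ e)
        }
      ; convex = bounded-convex
      }
    ; strong = bounded-strong
    }

  bounded-a : Bounded a
  bounded-a = 0 , 1 , ≤-reflexive (·-identityʳ a) , Neg-· a≤e (Neg-^ 1)

  bounded⊆stronglyConvex : ∀ {H} → IsStronglyConvex H → H a → ∀ {x} → Bounded x → H x
  bounded⊆stronglyConvex {H} H-sc Ha {x} (n , m , b≤x , xb≤e) =
    strong x (β n m) Hβ xb≤e (⇒-max (β n m) x e Q-e (≤-trans (≤-reflexive (·-identityʳ _)) b≤x))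
    where
    open IsStronglyConvex H-sc
    open SubalgebraProperties A (IsConvexSubalgebra.subalgebra convexSubalgebra)
    Hβ : H (β n m)
    Hβ = H-□^ (H-^ Ha m) n

  C[a]⇔bounded : ∀ x → C[ a ] x ⇔ Bounded x
  C[a]⇔bounded x = mk⇔ (λ x∈C → x∈C Bounded bounded-stronglyConvex bounded-a)
                       (λ bx H H-sc Ha → bounded⊆stronglyConvex H-sc Ha bx)

  C[a]⇔β-below : ∀ x → Neg x → C[ a ] x ⇔ (∃[ n ] ∃[ m ] β n m ≤ x)
  C[a]⇔β-below x x≤e = mk⇔
    (λ x∈C → let (n , m , β≤x , _) = Equivalence.to (C[a]⇔bounded x) x∈C in n , m , β≤x)
    (λ (n , m , β≤x) → Equivalence.from (C[a]⇔bounded x) (n , m , β≤x , Neg-· x≤e (Neg-β n m)))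

open SrlMonoid using (Carrier; _≤_; _·_; e)
open SrlNotions using (Neg; _^_; □^; C[_])

corollary4p4 : ∀ {ℓ : Level} (A : SrlMonoid ℓ) (a : Carrier A) → Neg A a →
    (∀ (x : Carrier A) → C[_] A a x ⇔
      (∃[ n ] ∃[ m ] (_≤_ A (□^ A n (_^_ A a m)) x × _≤_ A (_·_ A x (□^ A n (_^_ A a m))) (e A))))
    × (∀ (x : Carrier A) → Neg A x → C[_] A a x ⇔ (∃[ n ] ∃[ m ] (_≤_ A (□^ A n (_^_ A a m)) x)))
corollary4p4 A a a≤e = C[a]⇔bounded , C[a]⇔β-below
  where open BoxPowerBounds A a a≤e
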